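{- If a graph $G$ has an induced subgraph isomorphic to a member of $F$, then $G$ is not $12$-representable.
   Context: A labeled graph has distinct positive integers as vertices. A labeled graph $G=(V,E)$ is $12$-representable if there is a word $w$ whose set of letters is $V$ such that for all distinct $x,y\in V$: $xy\notin E$ iff some occurrence of $\min(x,y)$ precedes some occurrence of $\max(x,y)$ in $w$. An unlabeled graph is $12$-representable if some labeling (injective assignment of positive integers to its vertices) of it is $12$-representable. Let $X$ be the graph with vertices $a,b,c,d,e,f,g,h,i$ and edges $ab, bc, cd, de, ef, fc, bg, gf, gh, hi, if$. Let $C_m$ be the cycle graph on $m$ vertices, and $F=\{X\}\cup\{C_{2n}: n\ge 4\}$. -}

module Defs where

open import Data.Nat using (ℕ; zero; suc; _<_; _≤_; _*_; s≤s; z≤n)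
open import Data.Nat.Properties using (1+n≢n)
open import Data.Fin using (Fin; toℕ; zero; suc)
open import Data.List using (List; _++_)
open import Data.List.Membership.Propositional using (_∈_)
open import Data.Product using (Σ; ∃; ∃-syntax; _×_; _,_)
open import Data.Sum using (_⊎_; inj₁; inj₂)
open import Data.Bool using (Bool; true; false; T)
open import Data.Empty using (⊥)
open import Relation.Nullary using (¬_)
open import Relation.Binary.PropositionalEquality using (_≡_; refl; sym; trans)
open import Function.Definitions using (Injective)
open import Function.Bundles using (_⇔_)

record Graph : Set₁ where
  field
    n     : ℕ
    E     : Fin n → Fin n → Set
    E-sym : ∀ {x y} → E x y → E y x
    E-irr : ∀ {x} → ¬ E x x
open Graph public

Sym : ∀ {m} → (Fin m → Fin m → Set) → Fin m → Fin m → Set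
Sym B x y = B x y ⊎ B y x

Sym-sym : ∀ {m} {B : Fin m → Fin m → Set} {x y} → Sym B x y → Sym B y x
Sym-sym (inj₁ p) = inj₂ p
Sym-sym (inj₂ p) = inj₁ p

Precedes : ∀ {m} → List (Fin m) → Fin m → Fin m → Set
Precedes w x y = ∃[ xs ] ∃[ ys ] (w ≡ xs ++ ys × x ∈ xs × y ∈ ys)

record Labeling (G : Graph) : Set where
  field
    ℓ     : Fin (n G) → ℕ
    ℓ-inj : Injective _≡_ _≡_ ℓ
    ℓ-pos : ∀ v → 0 < ℓ v
open Labeling public

LabeledRep12 : (G : Graph) → Labeling G → Set
LabeledRep12 G L =
  ∃[ w ] ((∀ v → v ∈ w) ×
          (∀ x y → ℓ L x < ℓ L y → ((¬ E G x y) ⇔ Precedes w x y)))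

Rep12 : Graph → Set
Rep12 G = ∃[ L ] LabeledRep12 G L

HasInduced : Graph → Graph → Set
HasInduced G H =
  ∃[ f ] (Injective _≡_ _≡_ f × (∀ u v → (E H u v ⇔ E G (f u) (f v))))

CycB : (m : ℕ) → Fin m → Fin m → Set
CycB m i j = (toℕ j ≡ suc (toℕ i)) ⊎ (suc (toℕ i) ≡ m × toℕ j ≡ 0)

cyc-bad : ∀ {m k} → 3 ≤ m → suc k ≡ m → k ≡ 0 → ⊥
cyc-bad (s≤s (s≤s (s≤s _))) refl ()

CycB-irr : ∀ {m} → 3 ≤ m → ∀ {x} → ¬ Sym (CycB m) x x
CycB-irr h (inj₁ (inj₁ p)) = 1+n≢n (sym p)
CycB-irr h (inj₂ (inj₁ p)) = 1+n≢n (sym p)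
CycB-irr h (inj₁ (inj₂ (p , q))) = cyc-bad h p q
CycB-irr h (inj₂ (inj₂ (p , q))) = cyc-bad h p q

Cycle : (m : ℕ) → 3 ≤ m → Graph
Cycle m h = record { n = m ; E = Sym (CycB m) ; E-sym = Sym-sym {B = CycB m} ; E-irr = CycB-irr h }

4≤n⇒3≤2*n : ∀ {n} → 4 ≤ n → 3 ≤ 2 * n
4≤n⇒3≤2*n (s≤s (s≤s (s≤s (s≤s _)))) = s≤s (s≤s (s≤s z≤n))

-- The graph X: vertices a,b,c,d,e,f,g,h,i = 0,...,8, edges
-- ab, bc, cd, de, ef, fc, bg, gf, gh, hi, if.
XB : Fin 9 → Fin 9 → Bool
XB x y = go (toℕ x) (toℕ y)
  where
  go : ℕ → ℕ → Bool
  go 0 1 = true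
  go 1 2 = true
  go 2 3 = true
  go 3 4 = true
  go 4 5 = true
  go 5 2 = true
  go 1 6 = true
  go 6 5 = true
  go 6 7 = true
  go 7 8 = true
  go 8 5 = true
  go _ _ = false

XE : Fin 9 → Fin 9 → Set
XE = Sym (λ x y → T (XB x y))

XB-irr : ∀ (x : Fin 9) → ¬ T (XB x x)
XB-irr zero ()
XB-irr (suc zero) ()
XB-irr (suc (suc zero)) ()
XB-irr (suc (suc (suc zero))) ()
XB-irr (suc (suc (suc (suc zero)))) ()
XB-irr (suc (suc (suc (suc (suc zero))))) ()
XB-irr (suc (suc (suc (suc (suc (suc zero)))))) ()
XB-irr (suc (suc (suc (suc (suc (suc (suc zero))))))) ()
XB-irr (suc (suc (suc (suc (suc (suc (suc (suc zero)))))))) ()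

XE-irr : ∀ {x} → ¬ XE x x
XE-irr {x} (inj₁ p) = XB-irr x p
XE-irr {x} (inj₂ p) = XB-irr x p

X : Graph
X = record { n = 9 ; E = XE ; E-sym = Sym-sym {B = λ x y → T (XB x y)} ; E-irr = XE-irr }

module Submission where

-- A labelled 12-representation (ℓ, w) is abstracted into a
-- "12-structure" on the vertex set: a strict total order x ≺ y (the labels)
-- and a relation x ◁ y ("some x occurs before some y in w") which can be
-- split at any vertex and has the Ferrers property, such that for x ≺ y the
-- vertices x, y are non-adjacent iff x ◁ y.  Three closure properties make
-- this notion convenient: every 12-representation gives a 12-structure,
-- 12-structures restrict to induced subgraphs, and reversing both ≺ and ◁
-- gives the dual 12-structure, which mirrors every order-theoretic lemma.
--
-- In any 12-structure the middle vertex of an induced path x–y–z is a peak or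
-- a valley for ≺, and two "crossed" edges force a ≺-relation between their
-- ends (Ferrers).  For X we may assume b ≺ a by duality; the peaks and valleys
-- then alternate, and five crossings always close a ≺-cycle of length four.
-- For a cycle C_M with M ≥ 5 the same happens around the ≺-maximal vertex.
-- The theorem follows by restricting the 12-structure of G to the subgraph.

open import Defs
open import Data.Nat using (ℕ; _≤_; _*_)
open import Data.Product using (Σ; ∃-syntax; _×_)
open import Data.Sum using (_⊎_)
open import Relation.Nullary using (¬_)

open import Data.Bool using (Bool; T; not; _∨_)
open import Data.Bool.Properties using (T-∨; T-not-≡)
open import Data.Empty using (⊥; ⊥-elim)
open import Data.Fin using (Fin; zero; suc; toℕ; lower₁; #_)
open import Data.Fin.Properties using (toℕ-injective; toℕ<n; toℕ-lower₁)
open import Data.List using (List; []; _∷_; _++_; allFin)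
open import Data.List.Properties using (∷-injective)
open import Data.List.Membership.Propositional using (_∈_)
open import Data.List.Membership.Propositional.Properties using (∈-++⁻; ∈-++⁺ˡ; ∈-allFin)
open import Data.List.Relation.Unary.Any using (here; there)
open import Data.Nat using (suc; _<_; _+_; z≤n; s≤s; _≟_)
open import Data.Nat.GeneralisedArithmetic using (fold)
open import Data.Nat.Properties
  using (<-trans; <-cmp; <-irrefl; <⇒≤; <⇒≱; ≤-refl; ≤-trans; n≤1+n; m≤n+m;
         m+n≤o⇒n≤o; +-suc; +-identityʳ; +-cancelˡ-≡; +-cancelʳ-≡;
         +-mono-<-≤; *-monoʳ-≤; suc-injective; 0≢1+n)
open import Data.Product using (_,_; map₂)
open import Data.Sum using (inj₁; inj₂; [_,_]′; fromInj₂; swap)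
import Data.Sum as Sum
open import Function using (_∘_; flip)
open import Function.Bundles using (_⇔_; mk⇔; Equivalence)
open import Function.Construct.Composition using (_⇔-∘_)
open import Function.Definitions using (Injective)
open import Function.Related.TypeIsomorphisms using (¬-cong-⇔)
open import Relation.Binary.Consequences using (tri⇒irr)
open import Relation.Binary.Definitions using (Transitive; Trichotomous; tri<; tri≈; tri>)
import Relation.Binary.Construct.Flip.EqAndOrd as Flip
open import Relation.Binary.PropositionalEquality
  using (_≡_; _≢_; refl; sym; trans; cong; subst; module ≡-Reasoning)
open import Relation.Nullary using (yes; no)

private
  variable
    G H : Graph

prefixes-comparable : ∀ {A : Set} (a₁ b₁ a₂ b₂ : List A) → a₁ ++ b₁ ≡ a₂ ++ b₂ →
                      (∃[ c ] a₂ ≡ a₁ ++ c) ⊎ (∃[ c ] a₁ ≡ a₂ ++ c)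
prefixes-comparable []        _  a₂       _  _  = inj₁ (a₂ , refl)
prefixes-comparable (x ∷ a₁)  _  []       _  _  = inj₂ (x ∷ a₁ , refl)
prefixes-comparable (x ∷ a₁) b₁ (y ∷ a₂) b₂ eq with ∷-injective eq
... | refl , eq′ = Sum.map (map₂ (cong (x ∷_))) (map₂ (cong (x ∷_)))
                           (prefixes-comparable a₁ b₁ a₂ b₂ eq′)

module _ {m : ℕ} {w : List (Fin m)} where

  precedes-split : ∀ {x z} y → y ∈ w → Precedes w x z → Precedes w x y ⊎ Precedes w y z
  precedes-split y y∈w (xs , ys , refl , x∈xs , z∈ys) with ∈-++⁻ xs y∈w
  ... | inj₁ y∈xs = inj₂ (xs , ys , refl , y∈xs , z∈ys)
  ... | inj₂ y∈ys = inj₁ (xs , ys , refl , x∈xs , y∈ys)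

  -- The Ferrers property: precedences cut at comparable points of w.
  precedes-ferrers : ∀ {x₁ y₁ x₂ y₂} → Precedes w x₁ y₁ → Precedes w x₂ y₂ →
                     Precedes w x₁ y₂ ⊎ Precedes w x₂ y₁
  precedes-ferrers (a₁ , b₁ , w≡₁ , x₁∈ , y₁∈) (a₂ , b₂ , w≡₂ , x₂∈ , y₂∈)
    with prefixes-comparable a₁ b₁ a₂ b₂ (trans (sym w≡₁) w≡₂)
  ... | inj₁ (c , refl) = inj₁ (a₁ ++ c , b₂ , w≡₂ , ∈-++⁺ˡ x₁∈ , y₂∈)
  ... | inj₂ (c , refl) = inj₂ (a₂ ++ c , b₁ , w≡₁ , ∈-++⁺ˡ x₂∈ , y₁∈)

pullback-cmp : ∀ {A B : Set} {_<_ : B → B → Set} (f : A → B) → Injective _≡_ _≡_ f →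
               Trichotomous _≡_ _<_ → Trichotomous _≡_ (λ x y → f x < f y)
pullback-cmp f f-inj cmp x y with cmp (f x) (f y)
... | tri< a ¬b ¬c = tri< a (¬b ∘ cong f) ¬c
... | tri≈ ¬a b ¬c = tri≈ ¬a (f-inj b) ¬c
... | tri> ¬a ¬b c = tri> ¬a (¬b ∘ cong f) c

record Rep12Structure (H : Graph) : Set₁ where
  field
    _≺_       : Fin (n H) → Fin (n H) → Set
    ≺-trans   : Transitive _≺_
    ≺-cmp     : Trichotomous _≡_ _≺_
    _◁_       : Fin (n H) → Fin (n H) → Set
    ◁-split   : ∀ {x z} y → x ◁ z → x ◁ y ⊎ y ◁ z
    ◁-ferrers : ∀ {x₁ y₁ x₂ y₂} → x₁ ◁ y₁ → x₂ ◁ y₂ → x₁ ◁ y₂ ⊎ x₂ ◁ y₁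
    nonedge⇔◁ : ∀ {x y} → x ≺ y → ((¬ E H x y) ⇔ x ◁ y)

rep12-structure : Rep12 G → Rep12Structure G
rep12-structure (L , w , all∈w , rep) = record
  { _≺_       = λ x y → ℓ L x < ℓ L y
  ; ≺-trans   = <-trans
  ; ≺-cmp     = pullback-cmp (ℓ L) (ℓ-inj L) <-cmp
  ; _◁_       = Precedes w
  ; ◁-split   = λ y → precedes-split y (all∈w y)
  ; ◁-ferrers = precedes-ferrers
  ; nonedge⇔◁ = rep _ _
  }

restrict : HasInduced G H → Rep12Structure G → Rep12Structure H
restrict (f , f-inj , f-iso) S = record
  { _≺_       = λ u v → f u ≺ f v
  ; ≺-trans   = ≺-trans
  ; ≺-cmp     = pullback-cmp f f-inj ≺-cmp
  ; _◁_       = λ u v → f u ◁ f v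
  ; ◁-split   = λ y → ◁-split (f y)
  ; ◁-ferrers = ◁-ferrers
  ; nonedge⇔◁ = λ {u} {v} u≺v → nonedge⇔◁ u≺v ⇔-∘ ¬-cong-⇔ (f-iso u v)
  }
  where open Rep12Structure S

dual : Rep12Structure H → Rep12Structure H
dual {H} S = record
  { _≺_       = flip _≺_
  ; ≺-trans   = Flip.trans _≺_ ≺-trans
  ; ≺-cmp     = Flip.compare _≺_ ≺-cmp
  ; _◁_       = flip _◁_
  ; ◁-split   = λ y z◁x → swap (◁-split y z◁x)
  ; ◁-ferrers = λ y₁◁x₁ y₂◁x₂ → swap (◁-ferrers y₁◁x₁ y₂◁x₂)
  ; nonedge⇔◁ = λ y≺x → nonedge⇔◁ y≺x ⇔-∘ ¬-cong-⇔ (mk⇔ (E-sym H) (E-sym H))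
  }
  where open Rep12Structure S

module Basics {H : Graph} (S : Rep12Structure H) where
  open Rep12Structure S

  ≺-irrefl : ∀ {x} → ¬ x ≺ x
  ≺-irrefl = tri⇒irr ≺-cmp refl

  ≺-asym : ∀ {x y} → x ≺ y → ¬ y ≺ x
  ≺-asym x≺y y≺x = ≺-irrefl (≺-trans x≺y y≺x)

  no-4-cycle : ∀ {a b c d} → a ≺ b → b ≺ c → c ≺ d → ¬ d ≺ a
  no-4-cycle a≺b b≺c c≺d d≺a = ≺-irrefl (≺-trans a≺b (≺-trans b≺c (≺-trans c≺d d≺a)))

  edge⇒¬◁ : ∀ {x y} → x ≺ y → E H x y → ¬ x ◁ y
  edge⇒¬◁ x≺y xy x◁y = Equivalence.from (nonedge⇔◁ x≺y) x◁y xy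

  nonedge⇒◁ : ∀ {x y} → x ≺ y → ¬ E H x y → x ◁ y
  nonedge⇒◁ x≺y = Equivalence.to (nonedge⇔◁ x≺y)

  -- No induced path x–y–z is ≺-monotone: splitting x ◁ z at y hits an edge.
  no-monotone-path : ∀ {x y z} → E H x y → E H y z → ¬ E H x z → x ≺ y → ¬ y ≺ z
  no-monotone-path xy yz x≁z x≺y y≺z
    with ◁-split _ (nonedge⇒◁ (≺-trans x≺y y≺z) x≁z)
  ... | inj₁ x◁y = edge⇒¬◁ x≺y xy x◁y
  ... | inj₂ y◁z = edge⇒¬◁ y≺z yz y◁z

  peak : ∀ {x y z} → E H x y → E H y z → ¬ E H x z → x ≺ y → z ≺ y
  peak {y = y} {z} xy yz x≁z x≺y with ≺-cmp y z
  ... | tri< y≺z _ _ = ⊥-elim (no-monotone-path xy yz x≁z x≺y y≺z)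
  ... | tri≈ _ refl _ = ⊥-elim (E-irr H yz)
  ... | tri> _ _ z≺y = z≺y

  -- Two crossed edges t–b and t′–b′ (b ≺ t, b′ ≺ t′, t ≁ b′, t′ ≁ b):
  -- otherwise b′ ◁ t and b ◁ t′, and Ferrers puts ◁ on one of the edges.
  cross : ∀ {t b t′ b′} → E H t b → E H t′ b′ → ¬ E H t b′ → ¬ E H t′ b →
          b ≺ t → b′ ≺ t′ → t ≺ b′ ⊎ t′ ≺ b
  cross {t} {b} {t′} {b′} tb t′b′ t≁b′ t′≁b b≺t b′≺t′ with ≺-cmp t b′ | ≺-cmp t′ b
  ... | tri< t≺b′ _ _ | _ = inj₁ t≺b′
  ... | _ | tri< t′≺b _ _ = inj₂ t′≺b
  ... | tri≈ _ refl _ | _ =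
    ⊥-elim (no-monotone-path (E-sym H tb) (E-sym H t′b′) (t′≁b ∘ E-sym H) b≺t b′≺t′)
  ... | _ | tri≈ _ refl _ =
    ⊥-elim (no-monotone-path (E-sym H t′b′) (E-sym H tb) (t≁b′ ∘ E-sym H) b′≺t′ b≺t)
  ... | tri> _ _ b′≺t | tri> _ _ b≺t′
    with ◁-ferrers (nonedge⇒◁ b′≺t (t≁b′ ∘ E-sym H)) (nonedge⇒◁ b≺t′ (t′≁b ∘ E-sym H))
  ...   | inj₁ b′◁t′ = ⊥-elim (edge⇒¬◁ b′≺t′ (E-sym H t′b′) b′◁t′)
  ...   | inj₂ b◁t = ⊥-elim (edge⇒¬◁ b≺t (E-sym H tb) b◁t)

  IsMaximum : Fin (n H) → Set
  IsMaximum c = ∀ x → x ≡ c ⊎ x ≺ c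

  list-maximum : ∀ x xs → ∃[ c ] (∀ {y} → y ∈ x ∷ xs → y ≡ c ⊎ y ≺ c)
  list-maximum x [] = x , λ { (here refl) → inj₁ refl }
  list-maximum x (x′ ∷ xs) with list-maximum x′ xs
  ... | c , c-max with ≺-cmp x c
  ...   | tri< x≺c _ _ = c , λ { (here refl) → inj₂ x≺c ; (there y∈) → c-max y∈ }
  ...   | tri≈ _ refl _ = c , λ { (here refl) → inj₁ refl ; (there y∈) → c-max y∈ }
  ...   | tri> _ _ c≺x = x , λ { (here refl) → inj₁ refl ; (there y∈) → inj₂ (below (c-max y∈)) }
    where
    below : ∀ {y} → y ≡ c ⊎ y ≺ c → y ≺ x
    below = [ (λ { refl → c≺x }) , (λ y≺c → ≺-trans y≺c c≺x) ]′

  has-maximum : Fin (n H) → ∃[ c ] IsMaximum c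
  has-maximum v with list-maximum v (allFin (n H))
  ... | c , c-max = c , λ y → c-max (there (∈-allFin y))

module Properties {H : Graph} (S : Rep12Structure H) where
  open Rep12Structure S
  open Basics S public

  valley : ∀ {x y z} → E H x y → E H y z → ¬ E H x z → y ≺ x → y ≺ z
  valley = Basics.peak (dual S)

  -- Let w be a walk in H in which vertices two or three steps apart are
  -- non-adjacent.  Then w₃ is not the ≺-maximum: going outwards from w₃,
  -- peaks and valleys alternate, and two crossings give the ≺-cycle
  -- w₂ ≺ w₁ ≺ w₄ ≺ w₅ ≺ w₂.
  max-not-centre : (w : ℕ → Fin (n H)) → (∀ k → E H (w k) (w (suc k))) →
                   (∀ k → ¬ E H (w k) (w (2 + k))) → (∀ k → ¬ E H (w k) (w (3 + k))) →
                   ¬ IsMaximum (w 3)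
  max-not-centre w link gap₂ gap₃ w₃-max = no-4-cycle w₂≺w₁ w₁≺w₄ w₄≺w₅ w₅≺w₂
    where
    back : ∀ k → E H (w (suc k)) (w k)
    back k = E-sym H (link k)

    below : ∀ {x} → x ≢ w 3 → x ≺ w 3
    below {x} x≢w₃ = fromInj₂ (⊥-elim ∘ x≢w₃) (w₃-max x)

    w₀≺w₃ : w 0 ≺ w 3
    w₀≺w₃ = below λ w₀≡w₃ → gap₂ 0 (E-sym H (subst (E H (w 2)) (sym w₀≡w₃) (link 2)))
    w₂≺w₃ : w 2 ≺ w 3
    w₂≺w₃ = below λ w₂≡w₃ → E-irr H (subst (λ v → E H v (w 3)) w₂≡w₃ (link 2))
    w₄≺w₃ : w 4 ≺ w 3
    w₄≺w₃ = below λ w₄≡w₃ → E-irr H (subst (E H (w 3)) w₄≡w₃ (link 3))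
    w₆≺w₃ : w 6 ≺ w 3
    w₆≺w₃ = below λ w₆≡w₃ → gap₂ 4 (E-sym H (subst (λ v → E H v (w 4)) (sym w₆≡w₃) (link 3)))

    w₂≺w₁ : w 2 ≺ w 1
    w₂≺w₁ = valley (back 2) (back 1) (gap₂ 1 ∘ E-sym H) w₂≺w₃
    w₀≺w₁ : w 0 ≺ w 1
    w₀≺w₁ = peak (back 1) (back 0) (gap₂ 0 ∘ E-sym H) w₂≺w₁
    w₄≺w₅ : w 4 ≺ w 5
    w₄≺w₅ = valley (link 3) (link 4) (gap₂ 3) w₄≺w₃
    w₆≺w₅ : w 6 ≺ w 5
    w₆≺w₅ = peak (link 4) (link 5) (gap₂ 4) w₄≺w₅

    w₁≺w₄ : w 1 ≺ w 4
    w₁≺w₄ = fromInj₂ (⊥-elim ∘ ≺-asym w₀≺w₃)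
              (cross (link 3) (back 0) (gap₃ 0 ∘ E-sym H) (gap₃ 1) w₄≺w₃ w₀≺w₁)
    w₅≺w₂ : w 5 ≺ w 2
    w₅≺w₂ = fromInj₂ (⊥-elim ∘ ≺-asym w₆≺w₃)
              (cross (back 2) (link 5) (gap₃ 3) (gap₃ 2 ∘ E-sym H) w₂≺w₃ w₆≺w₅)

-- The graph X.  Adjacency is decidable, so its edges and non-edges can be
-- certified by computation.
module XGraph where
  a b c d e f g h i : Fin 9
  a = # 0
  b = # 1
  c = # 2
  d = # 3
  e = # 4
  f = # 5
  g = # 6
  h = # 7
  i = # 8

  adjacent : Fin 9 → Fin 9 → Bool
  adjacent u v = XB u v ∨ XB v u

  edge : ∀ u v → {T (adjacent u v)} → E X u v
  edge u v {uv} = Equivalence.to (T-∨ {XB u v} {XB v u}) uv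

  gap : ∀ u v → {T (not (adjacent u v))} → ¬ E X u v
  gap u v {u≁v} uv =
    subst T (Equivalence.to T-not-≡ u≁v) (Equivalence.from (T-∨ {XB u v} {XB v u}) uv)

  module _ (S : Rep12Structure X) where
    open Rep12Structure S
    open Properties S

    -- If b ≺ a, then peaks and valleys alternate along the induced paths of
    -- X starting at a–b, and every outcome of five crossings closes a
    -- ≺-cycle of length four.
    descending : ¬ b ≺ a
    descending b≺a = contradiction
      where
      b≺c : b ≺ c
      b≺c = valley (edge a b) (edge b c) (gap a c) b≺a
      b≺g : b ≺ g
      b≺g = valley (edge a b) (edge b g) (gap a g) b≺a
      d≺c : d ≺ c
      d≺c = peak (edge b c) (edge c d) (gap b d) b≺c
      f≺c : f ≺ c
      f≺c = peak (edge b c) (edge c f) (gap b f) b≺c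
      h≺g : h ≺ g
      h≺g = peak (edge b g) (edge g h) (gap b h) b≺g
      d≺e : d ≺ e
      d≺e = valley (edge c d) (edge d e) (gap c e) d≺c
      f≺e : f ≺ e
      f≺e = valley (edge c f) (edge f e) (gap c e) f≺c
      f≺i : f ≺ i
      f≺i = valley (edge c f) (edge f i) (gap c i) f≺c
      h≺i : h ≺ i
      h≺i = valley (edge g h) (edge h i) (gap g i) h≺g

      contradiction : ⊥
      contradiction with cross (edge a b) (edge e f) (gap a f) (gap e b) b≺a f≺e
      ... | inj₁ a≺f with cross (edge g b) (edge e d) (gap g d) (gap e b) b≺g d≺e
      ...   | inj₂ e≺b = no-4-cycle b≺a a≺f f≺e e≺b
      ...   | inj₁ g≺d with cross (edge i h) (edge c b) (gap i b) (gap c h) h≺i b≺c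
      ...     | inj₁ i≺b = no-4-cycle b≺a a≺f f≺i i≺b
      ...     | inj₂ c≺h = no-4-cycle h≺g g≺d d≺c c≺h
      contradiction | inj₂ e≺b with cross (edge a b) (edge i f) (gap a f) (gap i b) b≺a f≺i
      ...   | inj₁ a≺f = no-4-cycle b≺a a≺f f≺e e≺b
      ...   | inj₂ i≺b with cross (edge g h) (edge c d) (gap g d) (gap c h) h≺g d≺c
      ...     | inj₁ g≺d = no-4-cycle d≺e e≺b b≺g g≺d
      ...     | inj₂ c≺h = no-4-cycle h≺i i≺b b≺c c≺h

  -- Either b ≺ a, or b ≺ a in the dual structure.
  X-not-rep12 : ¬ Rep12Structure X
  X-not-rep12 S with Rep12Structure.≺-cmp S a b
  ... | tri< a≺b _ _ = descending (dual S) a≺b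
  ... | tri≈ _ () _
  ... | tri> _ _ b≺a = descending S b≺a

open XGraph using (X-not-rep12)

module _ {m : ℕ} where
  private
    M : ℕ
    M = suc m

  clockwise-functional : ∀ {x y z : Fin M} → CycB M x y → CycB M x z → y ≡ z
  clockwise-functional (inj₁ p) (inj₁ q) = toℕ-injective (trans p (sym q))
  clockwise-functional (inj₂ (_ , p)) (inj₂ (_ , q)) = toℕ-injective (trans p (sym q))
  clockwise-functional {y = y} (inj₁ p) (inj₂ (q , _)) = ⊥-elim (<-irrefl (trans p q) (toℕ<n y))
  clockwise-functional {z = z} (inj₂ (q , _)) (inj₁ p) = ⊥-elim (<-irrefl (trans p q) (toℕ<n z))

  clockwise-injective : ∀ {x y z : Fin M} → CycB M x z → CycB M y z → x ≡ y
  clockwise-injective (inj₁ p) (inj₁ q) = toℕ-injective (suc-injective (trans (sym p) q))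
  clockwise-injective (inj₂ (p , _)) (inj₂ (q , _)) = toℕ-injective (suc-injective (trans p (sym q)))
  clockwise-injective (inj₁ p) (inj₂ (_ , q)) = ⊥-elim (0≢1+n (trans (sym q) p))
  clockwise-injective (inj₂ (_ , q)) (inj₁ p) = ⊥-elim (0≢1+n (trans (sym q) p))

  next : Fin M → Fin M
  next x with m ≟ toℕ x
  ... | yes _   = zero
  ... | no m≢x = suc (lower₁ x m≢x)

  next-adj : ∀ x → CycB M x (next x)
  next-adj x with m ≟ toℕ x
  ... | yes m≡x = inj₂ (cong suc (sym m≡x) , refl)
  ... | no m≢x  = inj₁ (cong suc (toℕ-lower₁ x m≢x))

  next-injective : ∀ {x y} → next x ≡ next y → x ≡ y
  next-injective {x} {y} eq = clockwise-injective (next-adj x) (subst (CycB M y) (sym eq) (next-adj y))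

  adjacent-next : ∀ {x y} → Sym (CycB M) x y → y ≡ next x ⊎ x ≡ next y
  adjacent-next {x} {y} = Sum.map (λ xy → clockwise-functional xy (next-adj x))
                                  (λ yx → clockwise-functional yx (next-adj y))

  step : ℕ → Fin M → Fin M
  step d x = fold x next d

  toℕ-step : ∀ d x → d ≤ M → toℕ (step d x) ≡ toℕ x + d ⊎ toℕ (step d x) + M ≡ toℕ x + d
  toℕ-step 0 x _ = inj₁ (sym (+-identityʳ (toℕ x)))
  toℕ-step (suc d) x 1+d≤M with toℕ-step d x (<⇒≤ 1+d≤M) | next-adj (step d x)
  ... | inj₁ p | inj₁ q = inj₁ (trans q (trans (cong suc p) (sym (+-suc (toℕ x) d))))
  ... | inj₂ p | inj₁ q =
    inj₂ (trans (cong (_+ M) q) (trans (cong suc p) (sym (+-suc (toℕ x) d))))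
  ... | inj₁ p | inj₂ (q , r) =
    inj₂ (trans (cong (_+ M) r) (trans (sym q) (trans (cong suc p) (sym (+-suc (toℕ x) d)))))
  ... | inj₂ p | inj₂ (q , _) = ⊥-elim (<-irrefl wraps-twice (+-mono-<-≤ (toℕ<n x) 1+d≤M))
    where
    open ≡-Reasoning
    wraps-twice : toℕ x + suc d ≡ M + M
    wraps-twice = begin
      toℕ x + suc d            ≡⟨ +-suc (toℕ x) d ⟩
      suc (toℕ x + d)          ≡⟨ cong suc (sym p) ⟩
      suc (toℕ (step d x)) + M ≡⟨ cong (_+ M) q ⟩
      M + M                    ∎

  step-period : ∀ x → step M x ≡ x
  step-period x with toℕ-step M x ≤-refl
  ... | inj₁ p = ⊥-elim (<⇒≱ (toℕ<n (step M x)) (subst (M ≤_) (sym p) (m≤n+m M (toℕ x))))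
  ... | inj₂ p = toℕ-injective (+-cancelʳ-≡ M _ _ p)

  step-aperiodic : ∀ d x → 0 < d → d < M → step d x ≢ x
  step-aperiodic d x 0<d d<M eq with toℕ-step d x (<⇒≤ d<M)
  ... | inj₁ p = <-irrefl (sym (+-cancelˡ-≡ (toℕ x) d 0 d-vanishes)) 0<d
    where
    d-vanishes : toℕ x + d ≡ toℕ x + 0
    d-vanishes = trans (sym p) (trans (cong toℕ eq) (sym (+-identityʳ (toℕ x))))
  ... | inj₂ p = <-irrefl (+-cancelˡ-≡ (toℕ x) d M d-is-M) d<M
    where
    d-is-M : toℕ x + d ≡ toℕ x + M
    d-is-M = trans (sym p) (cong (_+ M) (cong toℕ eq))

  far-apart : ∀ e x → 3 + e < M → ¬ Sym (CycB M) x (step (2 + e) x)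
  far-apart e x 3+e<M xy with adjacent-next xy
  ... | inj₁ p = step-aperiodic (suc e) x (s≤s z≤n) (m+n≤o⇒n≤o 2 3+e<M) (next-injective p)
  ... | inj₂ p = step-aperiodic (3 + e) x (s≤s z≤n) 3+e<M (sym p)

-- Cycles of length at least 5 admit no 12-structure: the clockwise walk whose
-- vertex w₃ is the ≺-maximum contradicts `max-not-centre`.
cycle-not-rep12 : ∀ M (h : 3 ≤ M) → 5 ≤ M → ¬ Rep12Structure (Cycle M h)
cycle-not-rep12 (suc (suc (suc s))) (s≤s (s≤s (s≤s _))) 5≤M S with Basics.has-maximum S zero
... | t , t-max =
  Properties.max-not-centre S walk
    (λ k → inj₁ (next-adj (walk k)))
    (λ k → far-apart 0 (walk k) (≤-trans (n≤1+n 4) 5≤M))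
    (λ k → far-apart 1 (walk k) 5≤M)
    (subst (Basics.IsMaximum S) (sym (step-period t)) t-max)
  where
  walk : ℕ → Fin (3 + s)
  walk k = step (k + s) t

5≤2*k : ∀ {k} → 4 ≤ k → 5 ≤ 2 * k
5≤2*k 4≤k = ≤-trans (m≤n+m 5 3) (*-monoʳ-≤ 2 4≤k)

lemma7 : (G : Graph) →
    (HasInduced G X ⊎ (∃[ k ] Σ (4 ≤ k) (λ h → HasInduced G (Cycle (2 * k) (4≤n⇒3≤2*n h))))) →
    ¬ Rep12 G
lemma7 G (inj₁ X↪G) G-rep = X-not-rep12 (restrict X↪G (rep12-structure G-rep))
lemma7 G (inj₂ (k , 4≤k , C↪G)) G-rep =
  cycle-not-rep12 (2 * k) (4≤n⇒3≤2*n 4≤k) (5≤2*k 4≤k) (restrict C↪G (rep12-structure G-rep))
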